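{- There is no $2$-geodetic digraph with minimum out-degree at least $2$ and order $9$ whose in-degree sequence is $(1,2,\dots,2,3)$, i.e. exactly one vertex has in-degree $1$, exactly one has in-degree $3$, and all others have in-degree $2$.
   Context: A digraph is $2$-geodetic if for any two vertices $u,v$ there is at most one directed walk from $u$ to $v$ of length at most $2$. Note $9 = M(2,2)+2$ with $M(2,2)=1+2+4$. The in-degree sequence is the list of in-degrees in non-decreasing order. -}

module Defs where

open import Data.Nat using (ℕ; _≤_)
open import Data.Bool using (Bool; true; false; T)
open import Data.Bool.Properties using (T?)
open import Data.Fin using (Fin)
open import Data.List using (List; length; filter)
open import Data.List.Base using (allFin)
open import Relation.Binary.PropositionalEquality using (_≡_; _≢_)
open import Data.Product using (Σ; _×_; ∃₂)

-- A digraph on vertex set Fin n, given by its adjacency matrix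
-- (A u v ≡ true means there is an arc u → v; loops are not excluded a priori).
Digraph : ℕ → Set
Digraph n = Fin n → Fin n → Bool

data Walk≤2 {n : ℕ} (A : Digraph n) : Fin n → Fin n → Set where
  walk0 : (u : Fin n) → Walk≤2 A u u
  walk1 : (u v : Fin n) → A u v ≡ true → Walk≤2 A u v
  walk2 : (u w v : Fin n) → A u w ≡ true → A w v ≡ true → Walk≤2 A u v

TwoGeodetic : {n : ℕ} → Digraph n → Set
TwoGeodetic {n} A = (u v : Fin n) → (p q : Walk≤2 A u v) → p ≡ q

outdeg : {n : ℕ} → Digraph n → Fin n → ℕ
outdeg {n} A u = length (filter (λ v → T? (A u v)) (allFin n))

indeg : {n : ℕ} → Digraph n → Fin n → ℕ
indeg {n} A v = length (filter (λ u → T? (A u v)) (allFin n))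

MinOutDegreeAtLeast : {n : ℕ} → ℕ → Digraph n → Set
MinOutDegreeAtLeast {n} d A = (u : Fin n) → d ≤ outdeg A u

InSeq1-2-3 : {n : ℕ} → Digraph n → Set
InSeq1-2-3 {n} A = ∃₂ λ (a b : Fin n) →
  a ≢ b × indeg A a ≡ 1 × indeg A b ≡ 3 ×
  ((v : Fin n) → v ≢ a → v ≢ b → indeg A v ≡ 2)

module Submission where

-- Let a be the vertex of in-degree 1 and c the vertex of in-degree 3.  In a
-- 2-geodetic digraph two walks of length at most 2 into c that start at the same
-- vertex coincide, so walks into c with different routes have different sources
-- (`sources-injective`).  If a → c is not an arc, each of the three
-- in-neighbours of c has two in-neighbours, and the in-tree of c of depth 2
-- would have 1 + 3 + 6 = 10 distinct vertices.  If a → c is an arc, that tree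
-- has exactly 1 + 3 + (1 + 2 + 2) = 9 vertices and hence labels the whole
-- digraph.  After relabelling along the tree we know 8 arcs, a bound on every
-- in-degree, the local restrictions imposed by 2-geodecity, and that every
-- vertex has an out-neighbour avoiding any given vertex (`Admissible`).  A
-- certified exhaustive search (`Search`, proved sound in `refutes-sound`) then
-- shows by evaluation that these arcs cannot be completed.

open import Defs
open import Data.Nat using (ℕ; zero; suc; _≤_; z≤n; s≤s; _<ᵇ_)
open import Data.Nat.Properties using (≤-refl; n<1+n; <ᵇ⇒<; <⇒≱)
open import Data.Bool using (Bool; true; false; T; _∧_; _∨_; not; if_then_else_)
open import Data.Bool.Properties using (T?; T-≡; T-∧; T-∨)
open import Data.Bool.ListAction using (any; all)
open import Data.Fin using (Fin; zero; suc)
open import Data.Fin.Properties using (_≟_; any?; <⇒notInjective)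
open import Data.List using (List; []; _∷_; _++_; length; filter; allFin)
open import Data.List.Properties using (length-++-sucʳ; length-map)
open import Data.List.Membership.Propositional using (_∈_)
open import Data.List.Membership.Propositional.Properties
  using (∈-filter⁺; ∈-filter⁻; ∈-allFin; ∈-∃++; ∈-++⁻; ∈-++⁺ˡ; ∈-++⁺ʳ)
open import Data.List.Relation.Unary.Any using (here; there; satisfied)
open import Data.List.Relation.Unary.Any.Properties using (any⁻)
open import Data.List.Relation.Unary.All as All using (All; []; _∷_)
open import Data.List.Relation.Unary.All.Properties using (all⁺) renaming (map⁺ to All-map⁺)
open import Data.List.Relation.Unary.AllPairs using ([]; _∷_)
open import Data.List.Relation.Unary.Unique.Propositional using (Unique)
import Data.List.Relation.Unary.Unique.Propositional.Properties as Unique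
open import Data.Maybe using (Maybe; just; nothing)
open import Data.Product using (∃; ∃₂; _×_; _,_; proj₂)
open import Data.Sum using (inj₁; inj₂; [_,_]′)
open import Data.Unit using (tt)
open import Data.Vec using (Vec; lookup; updateAt; replicate)
open import Data.Vec.Properties using (lookup∘updateAt; lookup∘updateAt′; lookup-replicate)
open import Data.Empty using (⊥; ⊥-elim)
open import Function using (Equivalence; _∘_)
open import Function.Definitions using (Injective)
open import Relation.Nullary using (¬_; yes; no)
open import Relation.Nullary.Decidable using (isYes; toWitness; toWitnessFalse)
open import Relation.Binary.PropositionalEquality
  using (_≡_; _≢_; refl; sym; trans; cong; subst; subst₂; ≢-sym; module ≡-Reasoning)

private
  variable
    n m : ℕ

route : {A : Digraph n} {u v : Fin n} → Walk≤2 A u v → List (Fin n)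
route (walk0 u)         = u ∷ []
route (walk1 u v _)     = u ∷ v ∷ []
route (walk2 u m v _ _) = u ∷ m ∷ v ∷ []

-- Forbidden local configurations of a 2-geodetic digraph: each one yields two
-- distinct walks of length at most 2 between the same pair of vertices.
module TwoGeodeticFacts {A : Digraph n} (geo : TwoGeodetic A) where

  no-loop : ∀ {u} → A u u ≡ true → ⊥
  no-loop {u} uu with () ← geo u u (walk0 u) (walk1 u u uu)

  no-digon : ∀ {u v} → A u v ≡ true → A v u ≡ true → ⊥
  no-digon {u} {v} uv vu with () ← geo u u (walk0 u) (walk2 u v u uv vu)

  no-shortcut : ∀ {u m v} → A u m ≡ true → A m v ≡ true → A u v ≡ true → ⊥
  no-shortcut {u} {m} {v} um mv uv with () ← geo u v (walk1 u v uv) (walk2 u m v um mv)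

  unique-midpoint : ∀ {u m m′ v} → A u m ≡ true → A m v ≡ true →
                    A u m′ ≡ true → A m′ v ≡ true → m ≡ m′
  unique-midpoint {u} {m} {m′} {v} um mv um′ m′v
    with refl ← geo u v (walk2 u m v um mv) (walk2 u m′ v um′ m′v) = refl

  same-source⇒same-route : ∀ {u u′ v} (W : Walk≤2 A u v) (W′ : Walk≤2 A u′ v) →
                           u ≡ u′ → route W ≡ route W′
  same-source⇒same-route W W′ refl = cong route (geo _ _ W W′)

  -- Moore-tree principle: if a family of short walks into v can be told apart
  -- by their routes, then their sources are pairwise distinct.
  sources-injective : ∀ {v} (src : Fin m → Fin n) (walk : ∀ i → Walk≤2 A (src i) v)
                      (index : List (Fin n) → Fin m) →
                      (∀ i → index (route (walk i)) ≡ i) → Injective _≡_ _≡_ src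
  sources-injective src walk index index-route {i} {j} srcᵢ≡srcⱼ = begin
    i                        ≡⟨ sym (index-route i) ⟩
    index (route (walk i))   ≡⟨ cong index (same-source⇒same-route (walk i) (walk j) srcᵢ≡srcⱼ) ⟩
    index (route (walk j))   ≡⟨ index-route j ⟩
    j                        ∎
    where open ≡-Reasoning

unique-⊆⇒length-≤ : ∀ {a} {X : Set a} {xs ys : List X} → Unique xs →
                    (∀ {x} → x ∈ xs → x ∈ ys) → length xs ≤ length ys
unique-⊆⇒length-≤ {xs = []} _ _ = z≤n
unique-⊆⇒length-≤ {xs = x ∷ xs} (x∉xs ∷ xs-unique) xs⊆ys
  with us , vs , refl ← ∈-∃++ (xs⊆ys (here refl)) =
  subst (suc (length xs) ≤_) (sym (length-++-sucʳ us x vs))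
        (s≤s (unique-⊆⇒length-≤ xs-unique avoid-x))
  where
  avoid-x : ∀ {y} → y ∈ xs → y ∈ us ++ vs
  avoid-x {y} y∈xs with ∈-++⁻ us (xs⊆ys (there y∈xs))
  ... | inj₁ y∈us             = ∈-++⁺ˡ y∈us
  ... | inj₂ (here refl)      = ⊥-elim (All.lookup x∉xs y∈xs refl)
  ... | inj₂ (there y∈vs)     = ∈-++⁺ʳ us y∈vs

-- An injective map from Fin n to itself is onto: otherwise a missing value
-- would extend it to an injection Fin (suc n) → Fin n.
injective⇒surjective : (f : Fin n → Fin n) → Injective _≡_ _≡_ f → ∀ t → ∃ λ i → f i ≡ t
injective⇒surjective {n} f f-inj t with any? (λ i → f i ≟ t)
... | yes hit = hit
... | no miss = ⊥-elim (<⇒notInjective (s≤s ≤-refl) g-inj)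
  where
  g : Fin (suc n) → Fin n
  g zero    = t
  g (suc i) = f i
  g-inj : Injective _≡_ _≡_ g
  g-inj {zero}  {zero}  _ = refl
  g-inj {zero}  {suc j} e = ⊥-elim (miss (j , sym e))
  g-inj {suc i} {zero}  e = ⊥-elim (miss (i , e))
  g-inj {suc i} {suc j} e = cong suc (f-inj e)

module _ {a} {X : Set a} where

  some-member : ∀ {xs : List X} → length xs ≡ 1 → ∃ λ p → p ∈ xs
  some-member {xs = p ∷ []} _ = p , here refl

  two-members : ∀ {xs : List X} → Unique xs → length xs ≡ 2 →
                ∃₂ λ p q → p ≢ q × p ∈ xs × q ∈ xs
  two-members {xs = p ∷ q ∷ []} ((p≢q ∷ []) ∷ _) _ = p , q , p≢q , here refl , there (here refl)

  three-members : ∀ {xs : List X} → Unique xs → length xs ≡ 3 →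
                  ∃₂ λ p q → ∃ λ r → p ≢ q × p ≢ r × q ≢ r × p ∈ xs × q ∈ xs × r ∈ xs
  three-members {xs = p ∷ q ∷ r ∷ []} ((p≢q ∷ p≢r ∷ []) ∷ (q≢r ∷ []) ∷ _) _ =
    p , q , r , p≢q , p≢r , q≢r , here refl , there (here refl) , there (there (here refl))

  two-other-members : ∀ {xs : List X} {p} → Unique xs → length xs ≡ 3 → p ∈ xs →
                      ∃₂ λ q r → p ≢ q × p ≢ r × q ≢ r × q ∈ xs × r ∈ xs
  two-other-members {xs = p ∷ q ∷ r ∷ []} ((p≢q ∷ p≢r ∷ []) ∷ (q≢r ∷ []) ∷ _) _
                    (here refl) =
    q , r , p≢q , p≢r , q≢r , there (here refl) , there (there (here refl))
  two-other-members {xs = p ∷ q ∷ r ∷ []} ((p≢q ∷ p≢r ∷ []) ∷ (q≢r ∷ []) ∷ _) _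
                    (there (here refl)) =
    p , r , ≢-sym p≢q , q≢r , p≢r , here refl , there (there (here refl))
  two-other-members {xs = p ∷ q ∷ r ∷ []} ((p≢q ∷ p≢r ∷ []) ∷ (q≢r ∷ []) ∷ _) _
                    (there (there (here refl))) =
    p , q , ≢-sym p≢r , ≢-sym q≢r , p≢q , here refl , there (here refl)

module Neighbourhoods (A : Digraph n) where

  in-neighbours : Fin n → List (Fin n)
  in-neighbours v = filter (λ u → T? (A u v)) (allFin n)

  out-neighbours : Fin n → List (Fin n)
  out-neighbours u = filter (λ v → T? (A u v)) (allFin n)

  ∈-in-neighbours⁺ : ∀ {u v} → A u v ≡ true → u ∈ in-neighbours v
  ∈-in-neighbours⁺ {u} {v} uv =
    ∈-filter⁺ (λ u → T? (A u v)) (∈-allFin u) (Equivalence.from T-≡ uv)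

  ∈-in-neighbours⁻ : ∀ {u v} → u ∈ in-neighbours v → A u v ≡ true
  ∈-in-neighbours⁻ {v = v} u∈ =
    Equivalence.to T-≡ (proj₂ (∈-filter⁻ (λ u → T? (A u v)) {xs = allFin n} u∈))

  ∈-out-neighbours⁻ : ∀ {u v} → v ∈ out-neighbours u → A u v ≡ true
  ∈-out-neighbours⁻ {u} v∈ =
    Equivalence.to T-≡ (proj₂ (∈-filter⁻ (λ v → T? (A u v)) {xs = allFin n} v∈))

  in-neighbours-unique : ∀ v → Unique (in-neighbours v)
  in-neighbours-unique v = Unique.filter⁺ (λ u → T? (A u v)) (Unique.allFin⁺ n)

  out-neighbours-unique : ∀ u → Unique (out-neighbours u)
  out-neighbours-unique u = Unique.filter⁺ (λ v → T? (A u v)) (Unique.allFin⁺ n)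

  in-neighbour : ∀ {v} → indeg A v ≡ 1 → ∃ λ w → A w v ≡ true
  in-neighbour {v} one with w , w∈ ← some-member {xs = in-neighbours v} one =
    w , ∈-in-neighbours⁻ w∈

  two-in-neighbours : ∀ {v} → indeg A v ≡ 2 → ∃₂ λ p q → p ≢ q × A p v ≡ true × A q v ≡ true
  two-in-neighbours {v} two with p , q , p≢q , p∈ , q∈ ← two-members (in-neighbours-unique v) two =
    p , q , p≢q , ∈-in-neighbours⁻ p∈ , ∈-in-neighbours⁻ q∈

  in-degree-bound : ∀ {v xs} → Unique xs → All (λ u → A u v ≡ true) xs → length xs ≤ indeg A v
  in-degree-bound xs-unique arcs =
    unique-⊆⇒length-≤ xs-unique (λ u∈xs → ∈-in-neighbours⁺ (All.lookup arcs u∈xs))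

  out-neighbour-avoiding : ∀ {u} → 2 ≤ outdeg A u → ∀ k → ∃ λ l → l ≢ k × A u l ≡ true
  out-neighbour-avoiding {u} two k =
    avoid (out-neighbours u) (out-neighbours-unique u) two ∈-out-neighbours⁻
    where
    avoid : ∀ ts → Unique ts → 2 ≤ length ts → (∀ {v} → v ∈ ts → A u v ≡ true) →
            ∃ λ l → l ≢ k × A u l ≡ true
    avoid (t ∷ t′ ∷ _) ((t≢t′ ∷ _) ∷ _) _ arc with t ≟ k
    ... | no  t≢k  = t , t≢k , arc (here refl)
    ... | yes refl = t′ , (λ t′≡t → t≢t′ (sym t′≡t)) , arc (there (here refl))
    avoid (_ ∷ []) _ (s≤s ()) _

some : (Fin n → Bool) → Bool
some {n} P = any P (allFin n)

every : (Fin n → Bool) → Bool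
every {n} P = all P (allFin n)

some-witness : ∀ (P : Fin n → Bool) → T (some P) → ∃ λ i → T (P i)
some-witness {n} P holds = satisfied (any⁻ P (allFin n) holds)

every-instance : ∀ (P : Fin n → Bool) → T (every P) → ∀ i → T (P i)
every-instance {n} P holds i = All.lookup (all⁺ P (allFin n) holds) (∈-allFin i)

-- Boolean equality of vertices, so that the search can be run by evaluation.
_==_ : Fin n → Fin n → Bool
i == j = isYes (i ≟ j)

==⇒≡ : {i j : Fin n} → T (i == j) → i ≡ j
==⇒≡ {i = i} {j} = toWitness {a? = i ≟ j}

not-==⇒≢ : {i j : Fin n} → T (not (i == j)) → i ≢ j
not-==⇒≢ {i = i} {j} = toWitnessFalse {a? = i ≟ j}

==-refl : (i : Fin n) → (i == i) ≡ true
==-refl i with i ≟ i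
... | yes _   = refl
... | no i≢i = ⊥-elim (i≢i refl)

≢⇒==-false : {i j : Fin n} → i ≢ j → (i == j) ≡ false
≢⇒==-false {i = i} {j} i≢j with i ≟ j
... | yes i≡j = ⊥-elim (i≢j i≡j)
... | no _    = refl

ArcTable : ℕ → Set
ArcTable n = Vec (Vec Bool n) n

_⟨_,_⟩ : ArcTable n → Fin n → Fin n → Bool
G ⟨ i , j ⟩ = lookup (lookup G i) j

empty : ArcTable n
empty {n} = replicate n (replicate n false)

insert : ArcTable n → Fin n → Fin n → ArcTable n
insert G u v = updateAt G u (λ row → updateAt row v (λ _ → true))

fromArcs : List (Fin n × Fin n) → ArcTable n
fromArcs []             = empty
fromArcs ((u , v) ∷ as) = insert (fromArcs as) u v

_⊑_ : ArcTable n → Digraph n → Set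
G ⊑ B = ∀ i j → T (G ⟨ i , j ⟩) → B i j ≡ true

empty-⊑ : (B : Digraph n) → empty ⊑ B
empty-⊑ {n} B i j e
  rewrite lookup-replicate i (replicate n false) | lookup-replicate j false with () ← e

insert-⊑ : ∀ {B : Digraph n} {G u v} → G ⊑ B → B u v ≡ true → insert G u v ⊑ B
insert-⊑ {G = G} {u} {v} G⊑B uv i j e with i ≟ u | j ≟ v
... | yes refl | yes refl = uv
... | yes refl | no j≢v
  rewrite lookup∘updateAt u {λ row → updateAt row v (λ _ → true)} G
        | lookup∘updateAt′ j v {λ _ → true} j≢v (lookup G u) = G⊑B u j e
... | no i≢u | _
  rewrite lookup∘updateAt′ i u {λ row → updateAt row v (λ _ → true)} i≢u G = G⊑B i j e

fromArcs-⊑ : ∀ {B : Digraph n} as → All (λ (u , v) → B u v ≡ true) as → fromArcs as ⊑ B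
fromArcs-⊑ {B = B} []             []          = empty-⊑ B
fromArcs-⊑         ((u , v) ∷ as) (uv ∷ arcs) = insert-⊑ {G = fromArcs as} (fromArcs-⊑ as arcs) uv

record Admissible (B : Digraph n) (cap : Fin n → ℕ) : Set where
  field
    no-loop         : ∀ {u} → B u u ≡ true → ⊥
    no-digon        : ∀ {u v} → B u v ≡ true → B v u ≡ true → ⊥
    no-shortcut     : ∀ {u m v} → B u m ≡ true → B m v ≡ true → B u v ≡ true → ⊥
    unique-midpoint : ∀ {u m m′ v} → B u m ≡ true → B m v ≡ true →
                      B u m′ ≡ true → B m′ v ≡ true → m ≡ m′
    in-capacity     : ∀ {v xs} → Unique xs → All (λ u → B u v ≡ true) xs → length xs ≤ cap v
    out-neighbour-avoiding : ∀ u k → ∃ λ l → l ≢ k × B u l ≡ true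

-- Starting from a table G ⊑ B, it repeatedly
-- takes a vertex v with fewer than two known out-arcs, guesses a new out-arc
-- v → l, and discards the guess as soon as it violates admissibility.  The
-- order in which vertices are visited only affects the size of the search tree.
module Search {n} (cap : Fin n → ℕ) (order : List (Fin n)) where

  in-arcs : ArcTable n → Fin n → List (Fin n)
  in-arcs G v = filter (λ u → T? (G ⟨ u , v ⟩)) (allFin n)

  out-arcs : ArcTable n → Fin n → List (Fin n)
  out-arcs G u = filter (λ v → T? (G ⟨ u , v ⟩)) (allFin n)

  closes-shortcut : ArcTable n → Fin n → Fin n → Bool
  closes-shortcut G u v = some λ m →
    (G ⟨ u , m ⟩ ∧ G ⟨ m , v ⟩) ∨ (G ⟨ v , m ⟩ ∧ G ⟨ u , m ⟩) ∨ (G ⟨ m , u ⟩ ∧ G ⟨ m , v ⟩)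

  detour-after : ArcTable n → Fin n → Fin n → Fin n → Bool
  detour-after G u v q = G ⟨ v , q ⟩ ∧ some λ m → not (m == v) ∧ G ⟨ u , m ⟩ ∧ G ⟨ m , q ⟩

  detour-before : ArcTable n → Fin n → Fin n → Fin n → Bool
  detour-before G u v p = G ⟨ p , u ⟩ ∧ some λ m → not (m == u) ∧ G ⟨ p , m ⟩ ∧ G ⟨ m , v ⟩

  closes-double-route : ArcTable n → Fin n → Fin n → Bool
  closes-double-route G u v = some (detour-after G u v) ∨ some (detour-before G u v)

  over-capacity : ArcTable n → Fin n → Bool
  over-capacity G v = cap v <ᵇ length (in-arcs G v)

  violates : ArcTable n → Fin n → Fin n → Bool
  violates G u v = u == v ∨ G ⟨ v , u ⟩ ∨ closes-shortcut G u v ∨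
                   closes-double-route G u v ∨ over-capacity G v

  -- A vertex of `order` with fewer than two out-arcs in G, together with the
  -- out-neighbour that its next out-arc must avoid (itself if it has none).
  next-branch : ArcTable n → Maybe (Fin n × Fin n)
  next-branch G = first order
    where
    first : List (Fin n) → Maybe (Fin n × Fin n)
    first []       = nothing
    first (v ∷ vs) with out-arcs G v
    ... | []        = just (v , v)
    ... | k ∷ []    = just (v , k)
    ... | _ ∷ _ ∷ _ = first vs

  -- `refutes d G` holds when every branch of depth at most d below G reaches a
  -- violation; running out of depth or of branching vertices counts as failure.
  refutes : ℕ → ArcTable n → Bool
  refutes zero    G = false
  refutes (suc d) G with next-branch G
  ... | nothing      = false
  ... | just (v , k) =
    every λ l → l == k ∨ violates (insert G v l) v l ∨ refutes d (insert G v l)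

  module Soundness {B : Digraph n} (adm : Admissible B cap) where
    open Admissible adm

    private
      either : ∀ {x y} {C : Set} → (T x → C) → (T y → C) → T (x ∨ y) → C
      either f g = [ f , g ]′ ∘ Equivalence.to T-∨

      both : ∀ {x y} → T (x ∧ y) → T x × T y
      both = Equivalence.to T-∧

    shortcut-sound : ∀ {G u v} → G ⊑ B → B u v ≡ true → T (closes-shortcut G u v) → ⊥
    shortcut-sound {G} {u} {v} G⊑B uv holds with m , found ← some-witness _ holds =
      either {G ⟨ u , m ⟩ ∧ G ⟨ m , v ⟩} u→m→v
        (either {G ⟨ v , m ⟩ ∧ G ⟨ u , m ⟩} u→v→m m→u→v) found
      where
      u→m→v : T (G ⟨ u , m ⟩ ∧ G ⟨ m , v ⟩) → ⊥
      u→m→v h = let um , mv = both h in no-shortcut (G⊑B _ _ um) (G⊑B _ _ mv) uv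
      u→v→m : T (G ⟨ v , m ⟩ ∧ G ⟨ u , m ⟩) → ⊥
      u→v→m h = let vm , um = both h in no-shortcut uv (G⊑B _ _ vm) (G⊑B _ _ um)
      m→u→v : T (G ⟨ m , u ⟩ ∧ G ⟨ m , v ⟩) → ⊥
      m→u→v h = let mu , mv = both h in no-shortcut (G⊑B _ _ mu) uv (G⊑B _ _ mv)

    double-route-sound : ∀ {G u v} → G ⊑ B → B u v ≡ true → T (closes-double-route G u v) → ⊥
    double-route-sound {G} {u} {v} G⊑B uv = either {some (detour-after G u v)} after before
      where
      after : T (some (detour-after G u v)) → ⊥
      after holds
        with q , found ← some-witness (detour-after G u v) holds
        with vq , detour ← both {G ⟨ v , q ⟩} found
        with m , route ← some-witness (λ m → not (m == v) ∧ G ⟨ u , m ⟩ ∧ G ⟨ m , q ⟩) detour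
        with m≢v , um∧mq ← both {not (m == v)} route
        with um , mq ← both {G ⟨ u , m ⟩} um∧mq =
        not-==⇒≢ m≢v
          (sym (unique-midpoint uv (G⊑B _ _ vq) (G⊑B _ _ um) (G⊑B _ _ mq)))
      before : T (some (detour-before G u v)) → ⊥
      before holds
        with p , found ← some-witness (detour-before G u v) holds
        with pu , detour ← both {G ⟨ p , u ⟩} found
        with m , route ← some-witness (λ m → not (m == u) ∧ G ⟨ p , m ⟩ ∧ G ⟨ m , v ⟩) detour
        with m≢u , pm∧mv ← both {not (m == u)} route
        with pm , mv ← both {G ⟨ p , m ⟩} pm∧mv =
        not-==⇒≢ m≢u
          (sym (unique-midpoint (G⊑B _ _ pu) uv (G⊑B _ _ pm) (G⊑B _ _ mv)))

    capacity-sound : ∀ {G} v → G ⊑ B → T (over-capacity G v) → ⊥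
    capacity-sound {G} v G⊑B holds =
      <⇒≱ (<ᵇ⇒< (cap v) _ holds) (in-capacity (Unique.filter⁺ _ (Unique.allFin⁺ n)) arcs)
      where
      arcs : All (λ u → B u v ≡ true) (in-arcs G v)
      arcs = All.tabulate λ {u} u∈ →
        G⊑B u v (proj₂ (∈-filter⁻ (λ u → T? (G ⟨ u , v ⟩)) {xs = allFin n} u∈))

    violates-sound : ∀ G {u v} → G ⊑ B → B u v ≡ true → T (violates G u v) → ⊥
    violates-sound G {u} {v} G⊑B uv =
      either {u == v} (λ u==v → no-loop (subst (λ w → B u w ≡ true) (sym (==⇒≡ u==v)) uv))
      (either {G ⟨ v , u ⟩} (λ vu → no-digon uv (G⊑B _ _ vu))
      (either {closes-shortcut G u v} (shortcut-sound {G} G⊑B uv)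
      (either {closes-double-route G u v} (double-route-sound {G} G⊑B uv)
              (capacity-sound {G} v G⊑B))))

    refutes-sound : ∀ d G → G ⊑ B → T (refutes d G) → ⊥
    refutes-sound zero    G _   ()
    refutes-sound (suc d) G G⊑B holds with next-branch G
    ... | nothing      = holds
    ... | just (v , k) with l , l≢k , vl ← out-neighbour-avoiding v k =
      either {l == k} (λ l==k → l≢k (==⇒≡ l==k))
      (either {violates G′ v l} (violates-sound G′ G′⊑B vl) (refutes-sound d G′ G′⊑B))
      (every-instance _ holds l)
      where
      G′ : ArcTable n
      G′ = insert G v l
      G′⊑B : G′ ⊑ B
      G′⊑B = insert-⊑ {G = G} G⊑B vl

pattern F0 = zero
pattern F1 = suc F0
pattern F2 = suc F1
pattern F3 = suc F2
pattern F4 = suc F3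
pattern F5 = suc F4
pattern F6 = suc F5
pattern F7 = suc F6
pattern F8 = suc F7
pattern F9 = suc F8

module InTree {A : Digraph 9} (geo : TwoGeodetic A) {a c : Fin 9}
              (indeg-rest : ∀ v → v ≢ a → v ≢ c → indeg A v ≡ 2) where
  open TwoGeodeticFacts geo
  open Neighbourhoods A

  in-pair : ∀ {p} → A p c ≡ true → p ≢ a → ∃₂ λ q q′ → q ≢ q′ × A q p ≡ true × A q′ p ≡ true
  in-pair pc p≢a = two-in-neighbours (indeg-rest _ p≢a (λ { refl → no-loop pc }))

  -- Three in-neighbours of c, none equal to a, span an in-tree of depth 2 on
  -- 1 + 3 + 6 = 10 vertices, which cannot be distinct among 9.
  module TenVertices {p₁ p₂ p₃ q₁ q₁′ q₂ q₂′ q₃ q₃′ : Fin 9}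
    (p₁c : A p₁ c ≡ true) (p₂c : A p₂ c ≡ true) (p₃c : A p₃ c ≡ true)
    (q₁p₁ : A q₁ p₁ ≡ true) (q₁′p₁ : A q₁′ p₁ ≡ true)
    (q₂p₂ : A q₂ p₂ ≡ true) (q₂′p₂ : A q₂′ p₂ ≡ true)
    (q₃p₃ : A q₃ p₃ ≡ true) (q₃′p₃ : A q₃′ p₃ ≡ true)
    (p₁≢p₂ : p₁ ≢ p₂) (p₁≢p₃ : p₁ ≢ p₃) (p₂≢p₃ : p₂ ≢ p₃)
    (q₁≢q₁′ : q₁ ≢ q₁′) (q₂≢q₂′ : q₂ ≢ q₂′) (q₃≢q₃′ : q₃ ≢ q₃′) where

    vertex : Fin 10 → Fin 9
    vertex F0 = c
    vertex F1 = p₁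
    vertex F2 = p₂
    vertex F3 = p₃
    vertex F4 = q₁
    vertex F5 = q₁′
    vertex F6 = q₂
    vertex F7 = q₂′
    vertex F8 = q₃
    vertex F9 = q₃′

    walk : ∀ i → Walk≤2 A (vertex i) c
    walk F0 = walk0 c
    walk F1 = walk1 p₁ c p₁c
    walk F2 = walk1 p₂ c p₂c
    walk F3 = walk1 p₃ c p₃c
    walk F4 = walk2 q₁ p₁ c q₁p₁ p₁c
    walk F5 = walk2 q₁′ p₁ c q₁′p₁ p₁c
    walk F6 = walk2 q₂ p₂ c q₂p₂ p₂c
    walk F7 = walk2 q₂′ p₂ c q₂′p₂ p₂c
    walk F8 = walk2 q₃ p₃ c q₃p₃ p₃c
    walk F9 = walk2 q₃′ p₃ c q₃′p₃ p₃c

    index : List (Fin 9) → Fin 10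
    index (u ∷ _ ∷ [])     = if u == p₁ then F1 else if u == p₂ then F2 else F3
    index (u ∷ m ∷ _ ∷ []) =
      if m == p₁ then (if u == q₁ then F4 else F5) else
      if m == p₂ then (if u == q₂ then F6 else F7) else
                      (if u == q₃ then F8 else F9)
    index _                = F0

    index-route : ∀ i → index (route (walk i)) ≡ i
    index-route F0 = refl
    index-route F1 rewrite ==-refl p₁ = refl
    index-route F2 rewrite ≢⇒==-false (≢-sym p₁≢p₂) | ==-refl p₂ = refl
    index-route F3 rewrite ≢⇒==-false (≢-sym p₁≢p₃) | ≢⇒==-false (≢-sym p₂≢p₃) = refl
    index-route F4 rewrite ==-refl p₁ | ==-refl q₁ = refl
    index-route F5 rewrite ==-refl p₁ | ≢⇒==-false (≢-sym q₁≢q₁′) = refl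
    index-route F6 rewrite ≢⇒==-false (≢-sym p₁≢p₂) | ==-refl p₂ | ==-refl q₂ = refl
    index-route F7 rewrite ≢⇒==-false (≢-sym p₁≢p₂) | ==-refl p₂ | ≢⇒==-false (≢-sym q₂≢q₂′) = refl
    index-route F8 rewrite ≢⇒==-false (≢-sym p₁≢p₃) | ≢⇒==-false (≢-sym p₂≢p₃) | ==-refl q₃ = refl
    index-route F9 rewrite ≢⇒==-false (≢-sym p₁≢p₃) | ≢⇒==-false (≢-sym p₂≢p₃)
                         | ≢⇒==-false (≢-sym q₃≢q₃′) = refl

    impossible : ⊥
    impossible = <⇒notInjective (n<1+n 9) (sources-injective vertex walk index index-route)

  -- If a → c is an arc, the in-tree of c of depth 2 has exactly 1 + 3 + (1 + 2 + 2) = 9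
  -- vertices, so it labels the whole digraph. Relabelled along the tree, the
  -- digraph is admissible for the search, which then finds no completion.
  module NineVertices (out : MinOutDegreeAtLeast 2 A)
    (indeg-a : indeg A a ≡ 1) (indeg-c : indeg A c ≡ 3)
    {x y w x₁ x₂ y₁ y₂ : Fin 9}
    (ac : A a c ≡ true) (xc : A x c ≡ true) (yc : A y c ≡ true) (wa : A w a ≡ true)
    (x₁x : A x₁ x ≡ true) (x₂x : A x₂ x ≡ true) (y₁y : A y₁ y ≡ true) (y₂y : A y₂ y ≡ true)
    (a≢x : a ≢ x) (a≢y : a ≢ y) (x≢y : x ≢ y) (x₁≢x₂ : x₁ ≢ x₂) (y₁≢y₂ : y₁ ≢ y₂) where

    vertex : Fin 9 → Fin 9
    vertex F0 = c
    vertex F1 = a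
    vertex F2 = x
    vertex F3 = y
    vertex F4 = w
    vertex F5 = x₁
    vertex F6 = x₂
    vertex F7 = y₁
    vertex F8 = y₂

    walk : ∀ i → Walk≤2 A (vertex i) c
    walk F0 = walk0 c
    walk F1 = walk1 a c ac
    walk F2 = walk1 x c xc
    walk F3 = walk1 y c yc
    walk F4 = walk2 w a c wa ac
    walk F5 = walk2 x₁ x c x₁x xc
    walk F6 = walk2 x₂ x c x₂x xc
    walk F7 = walk2 y₁ y c y₁y yc
    walk F8 = walk2 y₂ y c y₂y yc

    index : List (Fin 9) → Fin 9
    index (u ∷ _ ∷ [])     = if u == a then F1 else if u == x then F2 else F3
    index (u ∷ m ∷ _ ∷ []) =
      if m == a then F4 else
      if m == x then (if u == x₁ then F5 else F6) else
                     (if u == y₁ then F7 else F8)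
    index _                = F0

    index-route : ∀ i → index (route (walk i)) ≡ i
    index-route F0 = refl
    index-route F1 rewrite ==-refl a = refl
    index-route F2 rewrite ≢⇒==-false (≢-sym a≢x) | ==-refl x = refl
    index-route F3 rewrite ≢⇒==-false (≢-sym a≢y) | ≢⇒==-false (≢-sym x≢y) = refl
    index-route F4 rewrite ==-refl a = refl
    index-route F5 rewrite ≢⇒==-false (≢-sym a≢x) | ==-refl x | ==-refl x₁ = refl
    index-route F6 rewrite ≢⇒==-false (≢-sym a≢x) | ==-refl x | ≢⇒==-false (≢-sym x₁≢x₂) = refl
    index-route F7 rewrite ≢⇒==-false (≢-sym a≢y) | ≢⇒==-false (≢-sym x≢y) | ==-refl y₁ = refl
    index-route F8 rewrite ≢⇒==-false (≢-sym a≢y) | ≢⇒==-false (≢-sym x≢y)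
                         | ≢⇒==-false (≢-sym y₁≢y₂) = refl

    vertex-injective : Injective _≡_ _≡_ vertex
    vertex-injective = sources-injective vertex walk index index-route

    vertex-surjective : ∀ t → ∃ λ i → vertex i ≡ t
    vertex-surjective = injective⇒surjective vertex vertex-injective

    B : Digraph 9
    B i j = A (vertex i) (vertex j)

    capacity : Fin 9 → ℕ
    capacity F0 = 3
    capacity F1 = 1
    capacity _  = 2

    indeg-vertex : ∀ i → indeg A (vertex i) ≡ capacity i
    indeg-vertex F0 = indeg-c
    indeg-vertex F1 = indeg-a
    indeg-vertex i@(suc (suc _)) =
      indeg-rest (vertex i) (not-a ∘ vertex-injective) (not-c ∘ vertex-injective)
      where
      not-a : i ≢ F1
      not-a ()
      not-c : i ≢ F0
      not-c ()

    admissible : Admissible B capacity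
    admissible = record
      { no-loop         = no-loop
      ; no-digon        = no-digon
      ; no-shortcut     = no-shortcut
      ; unique-midpoint = λ um mv um′ m′v → vertex-injective (unique-midpoint um mv um′ m′v)
      ; in-capacity     = in-capacity
      ; out-neighbour-avoiding = avoiding
      }
      where
      in-capacity : ∀ {v xs} → Unique xs → All (λ u → B u v ≡ true) xs → length xs ≤ capacity v
      in-capacity {v} {xs} xs-unique arcs =
        subst₂ _≤_ (length-map vertex xs) (indeg-vertex v)
          (in-degree-bound (Unique.map⁺ vertex-injective xs-unique) (All-map⁺ arcs))
      avoiding : ∀ u k → ∃ λ l → l ≢ k × B u l ≡ true
      avoiding u k with t , t≢k , ut ← out-neighbour-avoiding (out (vertex u)) (vertex k)
                   with l , refl ← vertex-surjective t =
        l , (λ l≡k → t≢k (cong vertex l≡k)) , ut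

    tree-arcs : List (Fin 9 × Fin 9)
    tree-arcs = (F1 , F0) ∷ (F2 , F0) ∷ (F3 , F0) ∷ (F4 , F1) ∷
                (F5 , F2) ∷ (F6 , F2) ∷ (F7 , F3) ∷ (F8 , F3) ∷ []

    tree-arcs-present : All (λ (u , v) → B u v ≡ true) tree-arcs
    tree-arcs-present = ac ∷ xc ∷ yc ∷ wa ∷ x₁x ∷ x₂x ∷ y₁y ∷ y₂y ∷ []

    open Search capacity (F6 ∷ F2 ∷ F5 ∷ F7 ∷ F3 ∷ F8 ∷ F0 ∷ F4 ∷ F1 ∷ [])

    impossible : ⊥
    impossible = Soundness.refutes-sound admissible 10 (fromArcs tree-arcs)
                   (fromArcs-⊑ tree-arcs tree-arcs-present) tt

  differs-from-a : A a c ≡ false → ∀ {p} → A p c ≡ true → p ≢ a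
  differs-from-a ¬ac pc refl with () ← trans (sym pc) ¬ac

  without-arc-ac : indeg A c ≡ 3 → A a c ≡ false → ⊥
  without-arc-ac indeg-c ¬ac
    with p₁ , p₂ , p₃ , p₁≢p₂ , p₁≢p₃ , p₂≢p₃ , p₁∈ , p₂∈ , p₃∈ ←
           three-members (in-neighbours-unique c) indeg-c
    with p₁c ← ∈-in-neighbours⁻ p₁∈ | p₂c ← ∈-in-neighbours⁻ p₂∈ | p₃c ← ∈-in-neighbours⁻ p₃∈
    with q₁ , q₁′ , q₁≢q₁′ , q₁p₁ , q₁′p₁ ← in-pair p₁c (differs-from-a ¬ac p₁c)
    with q₂ , q₂′ , q₂≢q₂′ , q₂p₂ , q₂′p₂ ← in-pair p₂c (differs-from-a ¬ac p₂c)
    with q₃ , q₃′ , q₃≢q₃′ , q₃p₃ , q₃′p₃ ← in-pair p₃c (differs-from-a ¬ac p₃c) =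
    TenVertices.impossible p₁c p₂c p₃c q₁p₁ q₁′p₁ q₂p₂ q₂′p₂ q₃p₃ q₃′p₃
                           p₁≢p₂ p₁≢p₃ p₂≢p₃ q₁≢q₁′ q₂≢q₂′ q₃≢q₃′

  with-arc-ac : MinOutDegreeAtLeast 2 A → indeg A a ≡ 1 → indeg A c ≡ 3 → A a c ≡ true → ⊥
  with-arc-ac out indeg-a indeg-c ac
    with x , y , a≢x , a≢y , x≢y , x∈ , y∈ ←
           two-other-members (in-neighbours-unique c) indeg-c (∈-in-neighbours⁺ ac)
    with xc ← ∈-in-neighbours⁻ x∈ | yc ← ∈-in-neighbours⁻ y∈
    with w , wa ← in-neighbour indeg-a
    with x₁ , x₂ , x₁≢x₂ , x₁x , x₂x ← in-pair xc (≢-sym a≢x)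
    with y₁ , y₂ , y₁≢y₂ , y₁y , y₂y ← in-pair yc (≢-sym a≢y) =
    NineVertices.impossible out indeg-a indeg-c ac xc yc wa x₁x x₂x y₁y y₂y
                            a≢x a≢y x≢y x₁≢x₂ y₁≢y₂

theorem5 : (A : Digraph 9) →
    ¬ (TwoGeodetic A × MinOutDegreeAtLeast 2 A × InSeq1-2-3 A)
theorem5 A (geo , out , a , c , _ , indeg-a , indeg-c , indeg-rest) with A a c in ac
... | true  = InTree.with-arc-ac geo indeg-rest out indeg-a indeg-c ac
... | false = InTree.without-arc-ac geo indeg-rest indeg-c ac
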